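{- Every elementary self-complementary pseudo-split graph is a self-complementary pseudo-split graph, and its degree sequence is forcibly self-complementary.
   Context: All graphs are finite and simple. A graph is self-complementary if it is isomorphic to its complement. The degree sequence of a graph is the non-increasing list of its vertex degrees; a realization of a degree sequence is any graph with that degree sequence; a degree sequence is forcibly self-complementary if every realization of it is self-complementary. A split graph has vertex set partitioned into a clique and an independent set. A pseudo-split graph is a graph whose vertex set can be partitioned into a clique $K$, an independent set $I$ and a set $C$ which is either empty or induces a 5-cycle, is complete to $K$ and has no edges to $I$. Let $A_8$ (resp. $B_8$) be the split graph on 8 vertices with clique $\{c_1,c_2,c_3,c_4\}$ and independent set $\{u_1,u_2,u_3,u_4\}$ whose edges between these sets are: for $A_8$, $u_1\sim c_1,c_2$; $u_2\sim c_1,c_3$; $u_3\sim c_2,c_4$; $u_4\sim c_3,c_4$; for $B_8$, $u_1,u_2\sim c_1,c_2$ and $u_3,u_4\sim c_3,c_4$. Each of $P_4$, $A_8$, $B_8$ has a unique split partition (for $P_4$ the clique is its two inner vertices). An elementary self-complementary pseudo-split graph is constructed as follows: take $p\ge0$ vertex-disjoint graphs $S_1,\dots,S_p$, each isomorphic to $P_4$, $A_8$ or $B_8$, with split partitions $K_i\uplus I_i$, and a further set $C$ of $0$, $1$ or $5$ vertices; add all edges making $\bigcup_i K_i$ a clique; for each $i$ add all edges between $K_i$ and $\bigcup_{j>i}I_j$; add all edges between $C$ and $\bigcup_iK_i$; and if $|C|=5$ add edges making $C$ a 5-cycle. No other edges are added. -}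

module Defs where

open import Data.Nat using (ℕ; zero; suc; _+_; _%_; _≡ᵇ_; _<ᵇ_)
open import Data.Nat.Properties using (≤-decTotalOrder)
open import Data.Bool using (Bool; true; false; not; _∧_; _∨_; if_then_else_)
open import Data.Fin using (Fin; toℕ; _≟_)
open import Data.List using (List; length; lookup; map; allFin)
open import Data.Nat.ListAction using (sum)
open import Data.Product using (Σ; ∃; _×_; _,_)
open import Data.Sum using (_⊎_; inj₁; inj₂)
open import Relation.Binary.PropositionalEquality using (_≡_; _≢_; refl)
open import Relation.Nullary using (yes; no)
open import Function.Bundles using (_↔_; Inverse)
open import Function.Definitions using (Injective)
open import Relation.Binary.Properties.DecTotalOrder ≤-decTotalOrder using (≥-decTotalOrder)
import Data.List.Sort

record Graph (n : ℕ) : Set where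
  field
    adj    : Fin n → Fin n → Bool
    sym    : ∀ u v → adj u v ≡ adj v u
    irrefl : ∀ v → adj v v ≡ false
open Graph public

complement : ∀ {n} → Graph n → Graph n
complement {n} G = record
  { adj = cadj ; sym = csym ; irrefl = cirr }
  where
  cadj : Fin n → Fin n → Bool
  cadj u v with u ≟ v
  ... | yes _ = false
  ... | no  _ = not (adj G u v)
  csym : ∀ u v → cadj u v ≡ cadj v u
  csym u v with u ≟ v | v ≟ u
  ... | yes _ | yes _ = refl
  ... | yes refl | no v≢u = Data.Empty.⊥-elim (v≢u refl)
    where import Data.Empty
  ... | no u≢v | yes refl = Data.Empty.⊥-elim (u≢v refl)
    where import Data.Empty
  ... | no _ | no _ rewrite sym G u v = refl
  cirr : ∀ v → cadj v v ≡ false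
  cirr v with v ≟ v
  ... | yes _ = refl
  ... | no v≢v = Data.Empty.⊥-elim (v≢v refl)
    where import Data.Empty

_≅_ : ∀ {n m} → Graph n → Graph m → Set
_≅_ {n} {m} G H = Σ (Fin n ↔ Fin m) λ f →
  ∀ u v → adj G u v ≡ adj H (Inverse.to f u) (Inverse.to f v)

SelfComplementary : ∀ {n} → Graph n → Set
SelfComplementary G = G ≅ complement G

degree : ∀ {n} → Graph n → Fin n → ℕ
degree {n} G v = sum (map (λ u → if adj G v u then 1 else 0) (allFin n))

module SortDesc = Data.List.Sort ≥-decTotalOrder

degreeSequence : ∀ {n} → Graph n → List ℕ
degreeSequence {n} G = SortDesc.sort (map (degree G) (allFin n))

ForciblySelfComplementary : List ℕ → Set
ForciblySelfComplementary d =
  ∀ (m : ℕ) (H : Graph m) → degreeSequence H ≡ d → SelfComplementary H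

data Part : Set where
  inK inI inC : Part

cyc5 : Fin 5 → Fin 5 → Bool
cyc5 x y = (suc (toℕ x) % 5 ≡ᵇ toℕ y) ∨ (suc (toℕ y) % 5 ≡ᵇ toℕ x)

InducesC5 : ∀ {n} → Graph n → (Fin n → Part) → Set
InducesC5 {n} G part = Σ (Fin 5 → Fin n) λ g →
    Injective _≡_ _≡_ g
  × (∀ i → part (g i) ≡ inC)
  × (∀ v → part v ≡ inC → ∃ λ i → g i ≡ v)
  × (∀ i j → adj G (g i) (g j) ≡ cyc5 i j)

PseudoSplit : ∀ {n} → Graph n → Set
PseudoSplit {n} G = Σ (Fin n → Part) λ part →
    (∀ u v → u ≢ v → part u ≡ inK → part v ≡ inK → adj G u v ≡ true)
  × (∀ u v → part u ≡ inI → part v ≡ inI → adj G u v ≡ false)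
  × (∀ u v → part u ≡ inC → part v ≡ inK → adj G u v ≡ true)
  × (∀ u v → part u ≡ inC → part v ≡ inI → adj G u v ≡ false)
  × ((∀ v → part v ≢ inC) ⊎ InducesC5 G part)

data Kind : Set where
  P4 A8 B8 : Kind

size : Kind → ℕ
size P4 = 4
size A8 = 8
size B8 = 8

-- P4: path 0-1-2-3, clique {1,2}, independent {0,3}
-- A8, B8: clique c1..c4 = 0..3, independent u1..u4 = 4..7
inClique : (k : Kind) → Fin (size k) → Bool
inClique P4 a = (toℕ a ≡ᵇ 1) ∨ (toℕ a ≡ᵇ 2)
inClique A8 a = toℕ a <ᵇ 4
inClique B8 a = toℕ a <ᵇ 4

-- edges listed with smaller endpoint first
edgeP4 : ℕ → ℕ → Bool
edgeP4 0 1 = true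
edgeP4 1 2 = true
edgeP4 2 3 = true
edgeP4 _ _ = false

cliqueEdge : ℕ → ℕ → Bool
cliqueEdge 0 1 = true
cliqueEdge 0 2 = true
cliqueEdge 0 3 = true
cliqueEdge 1 2 = true
cliqueEdge 1 3 = true
cliqueEdge 2 3 = true
cliqueEdge _ _ = false

edgeA8 : ℕ → ℕ → Bool
edgeA8 0 4 = true
edgeA8 1 4 = true
edgeA8 0 5 = true
edgeA8 2 5 = true
edgeA8 1 6 = true
edgeA8 3 6 = true
edgeA8 2 7 = true
edgeA8 3 7 = true
edgeA8 a b = cliqueEdge a b

edgeB8 : ℕ → ℕ → Bool
edgeB8 0 4 = true
edgeB8 1 4 = true
edgeB8 0 5 = true
edgeB8 1 5 = true
edgeB8 2 6 = true
edgeB8 3 6 = true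
edgeB8 2 7 = true
edgeB8 3 7 = true
edgeB8 a b = cliqueEdge a b

edge : Kind → ℕ → ℕ → Bool
edge P4 = edgeP4
edge A8 = edgeA8
edge B8 = edgeB8

localAdj : (k : Kind) → Fin (size k) → Fin (size k) → Bool
localAdj k a b = edge k (toℕ a) (toℕ b) ∨ edge k (toℕ b) (toℕ a)

data CSize : Set where
  c0 c1 c5 : CSize

csize : CSize → ℕ
csize c0 = 0
csize c1 = 1
csize c5 = 5

cAdj : (c : CSize) → Fin (csize c) → Fin (csize c) → Bool
cAdj c5 x y = cyc5 x y
cAdj c1 _ _ = false
cAdj c0 _ _ = false

Vtx : List Kind → CSize → Set
Vtx ts c = (Σ (Fin (length ts)) λ i → Fin (size (lookup ts i))) ⊎ Fin (csize c)

blockAdj : (ts : List Kind) (i j : Fin (length ts)) →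
           Fin (size (lookup ts i)) → Fin (size (lookup ts j)) → Bool
blockAdj ts i j a b with i ≟ j
... | yes refl = localAdj (lookup ts i) a b
... | no _ =
      (ka ∧ kb)                                  -- ⋃ K_i is a clique
    ∨ ((toℕ i <ᵇ toℕ j) ∧ ka ∧ not kb)           -- K_i to I_j, j > i
    ∨ ((toℕ j <ᵇ toℕ i) ∧ kb ∧ not ka)           -- K_j to I_i, i > j
  where
  ka = inClique (lookup ts i) a
  kb = inClique (lookup ts j) b

elemAdj : (ts : List Kind) (c : CSize) → Vtx ts c → Vtx ts c → Bool
elemAdj ts c (inj₁ (i , a)) (inj₁ (j , b)) = blockAdj ts i j a b
elemAdj ts c (inj₁ (i , a)) (inj₂ x) = inClique (lookup ts i) a
elemAdj ts c (inj₂ x) (inj₁ (j , b)) = inClique (lookup ts j) b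
elemAdj ts c (inj₂ x) (inj₂ y) = cAdj c x y

ElementarySCPseudoSplit : ∀ {n} → Graph n → Set
ElementarySCPseudoSplit {n} G =
  Σ (List Kind) λ ts → Σ CSize λ c → Σ (Fin n ↔ Vtx ts c) λ φ →
    ∀ u v → adj G u v ≡ elemAdj ts c (Inverse.to φ u) (Inverse.to φ v)

-- An elementary graph G has an antimorphism acting inside each block S_i, where it exchanges
-- K_i and I_i, and inside C.  For forcibility let H realise the degree sequence of G, relabelled
-- so that every vertex has the same degree in H as in G.  For each i, the clique vertices A of
-- S_0, …, S_i are adjacent in G to every vertex outside the independent vertices B of S_0, …, S_i,
-- and B has no neighbour outside A; counting the edges leaving A and B shows that H inherits both
-- properties.  Hence H agrees with G between different units (blocks and C), and inside each unit
-- it has the local degrees of P4, A8, B8 or C5 with K_i a clique and I_i independent.  An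
-- exhaustive search shows that every such local graph has an antimorphism exchanging K_i and I_i,
-- and these glue to an antimorphism of H.  For pseudo-splitness take K = ⋃ K_i and I = ⋃ I_i,
-- adding C to K when |C| = 1.

module Submission where

open import Defs hiding (sym)

open import Data.Bool using (Bool; true; false; not; _∧_; _∨_; _xor_; if_then_else_)
open import Data.Bool.ListAction using (any)
open import Data.Bool.Properties using (not-involutive; ∧-conicalˡ; ∧-conicalʳ; ∧-zeroʳ; T-≡)
open import Data.Empty using (⊥-elim)
open import Data.Fin using (Fin; zero; suc; toℕ; cast; punchIn; _≟_; #_)
open import Data.Fin.Properties using (toℕ-injective; cast-involutive; punchInᵢ≢i)
open import Data.List using (List; []; _∷_; length; lookup; map; allFin; tabulate)
open import Data.List.Properties using (map-tabulate; length-tabulate; lookup-tabulate)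
open import Data.List.Relation.Binary.Permutation.Propositional
  using (_↭_; ↭⇒↭ₛ; module PermutationReasoning)
open import Data.Maybe using (Maybe; just; nothing)
open import Data.Nat using (ℕ; zero; suc; _+_; _≤_; _<_; z≤n; s≤s; _≡ᵇ_; _<ᵇ_)
import Data.Nat.ListAction as ListAction
open import Data.Nat.Properties
  using ( +-0-commutativeMonoid; +-comm; +-assoc; +-identityʳ; +-cancelʳ-≡; +-cancelˡ-≤; +-cancelʳ-≤
        ; +-mono-≤; +-monoˡ-≤; +-monoʳ-≤; m+n≡0⇒m≡0; m+n≡0⇒n≡0; n≤0⇒n≡0; ≤-refl; ≤-reflexive; ≤-trans
        ; ≤-antisym; <⇒≤; <⇒≱; ≮⇒≥; ≤∧≢⇒<; <ᵇ⇒<; <⇒<ᵇ; ≡⇒≡ᵇ; module ≤-Reasoning)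
open import Data.Product using (Σ; ∃; _×_; _,_; proj₁; proj₂)
open import Data.Sum using (_⊎_; inj₁; inj₂)
open import Data.Vec using (Vec; []; _∷_)
import Data.Vec as Vec
open import Data.Vec.Properties using (lookup∘tabulate)
open import Function using (_∘_; id; case_of_)
open import Function.Bundles using (_↔_; Inverse; mk↔ₛ′; Equivalence)
open import Function.Properties.Inverse using (↔-refl; ↔-trans; ↔-sym)
open import Relation.Binary.PropositionalEquality
open import Relation.Nullary using (yes; no; does)

open import Algebra.Properties.CommutativeMonoid.Sum +-0-commutativeMonoid
  using (sum; ∑-distrib-+; ∑-comm; sum-cong-≗; sum-replicate-zero; ∑-permute; sum-remove)
open import Data.List.Relation.Binary.Permutation.Setoid (setoid ℕ) using (onIndices)
open import Data.List.Relation.Binary.Permutation.Setoid.Properties (setoid ℕ) using (onIndices-lookup)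

open Inverse using (to; from; strictlyInverseˡ; strictlyInverseʳ)

𝟙 : Bool → ℕ
𝟙 b = if b then 1 else 0

𝟙-injective : ∀ {x y} → 𝟙 x ≡ 𝟙 y → x ≡ y
𝟙-injective {false} {false} _ = refl
𝟙-injective {true}  {true}  _ = refl

𝟙-split : ∀ p q x → 𝟙 (p ∧ x) ≡ 𝟙 (p ∧ q ∧ x) + 𝟙 (p ∧ not q ∧ x)
𝟙-split false q     x = refl
𝟙-split true  true  x = sym (+-identityʳ (𝟙 x))
𝟙-split true  false x = refl

𝟙≤1 : ∀ x → 𝟙 x ≤ 1
𝟙≤1 false = z≤n
𝟙≤1 true  = s≤s z≤n

+-mono-≤-tight : ∀ {a b c d} → a ≤ c → b ≤ d → a + b ≡ c + d → a ≡ c × b ≡ d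
+-mono-≤-tight {a} {b} {c} {d} a≤c b≤d eq = ≤-antisym a≤c c≤a , ≤-antisym b≤d d≤b
  where
  c≤a : c ≤ a
  c≤a = +-cancelʳ-≤ d c a (≤-trans (≤-reflexive (sym eq)) (+-monoʳ-≤ a b≤d))
  d≤b : d ≤ b
  d≤b = +-cancelˡ-≤ c d b (≤-trans (≤-reflexive (sym eq)) (+-monoˡ-≤ b a≤c))

∑-mono-≤ : ∀ {n} {f g : Fin n → ℕ} → (∀ i → f i ≤ g i) → sum f ≤ sum g
∑-mono-≤ {zero}  f≤g = z≤n
∑-mono-≤ {suc n} f≤g = +-mono-≤ (f≤g zero) (∑-mono-≤ (f≤g ∘ suc))

∑-mono-≤-tight : ∀ {n} {f g : Fin n → ℕ} → (∀ i → f i ≤ g i) → sum f ≡ sum g → ∀ i → f i ≡ g i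
∑-mono-≤-tight {suc n} f≤g eq zero = proj₁ (+-mono-≤-tight (f≤g zero) (∑-mono-≤ (f≤g ∘ suc)) eq)
∑-mono-≤-tight {suc n} f≤g eq (suc i) =
  ∑-mono-≤-tight (f≤g ∘ suc) (proj₂ (+-mono-≤-tight (f≤g zero) (∑-mono-≤ (f≤g ∘ suc)) eq)) i

∑-zero : ∀ {n} {f : Fin n → ℕ} → (∀ i → f i ≡ 0) → sum f ≡ 0
∑-zero {n} f≡0 = trans (sum-cong-≗ f≡0) (sum-replicate-zero n)

∑≡0⇒≡0 : ∀ {n} {f : Fin n → ℕ} → sum f ≡ 0 → ∀ i → f i ≡ 0
∑≡0⇒≡0 {suc n} eq zero    = m+n≡0⇒m≡0 _ eq
∑≡0⇒≡0 {suc n} eq (suc i) = ∑≡0⇒≡0 (m+n≡0⇒n≡0 _ eq) i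

[_≟_]·_ : ∀ {n} → Fin n → Fin n → ℕ → ℕ
[ x ≟ y ]· k = if does (x ≟ y) then k else 0

[≟]·-refl : ∀ {n} (x : Fin n) k → [ x ≟ x ]· k ≡ k
[≟]·-refl x k with x ≟ x
... | yes _   = refl
... | no x≢x = ⊥-elim (x≢x refl)

[≟]·-≢ : ∀ {n} {x y : Fin n} k → x ≢ y → [ x ≟ y ]· k ≡ 0
[≟]·-≢ {x = x} {y} k x≢y with x ≟ y
... | yes x≡y = ⊥-elim (x≢y x≡y)
... | no _    = refl

[≟]·-zero : ∀ {n} (x y : Fin n) → [ x ≟ y ]· 0 ≡ 0
[≟]·-zero x y with x ≟ y
... | yes _ = refl
... | no _  = refl

∑-single : ∀ {n} (w : Fin n) (h : Fin n → ℕ) → sum (λ v → [ v ≟ w ]· h v) ≡ h w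
∑-single {suc n} w h = begin
  sum t                        ≡⟨ sum-remove {i = w} t ⟩
  t w + sum (t ∘ punchIn w)    ≡⟨ cong₂ _+_ ([≟]·-refl w (h w)) (∑-zero (λ j → [≟]·-≢ _ (punchInᵢ≢i w j))) ⟩
  h w + 0                      ≡⟨ +-identityʳ (h w) ⟩
  h w                          ∎
  where
  open ≡-Reasoning
  t : Fin _ → ℕ
  t v = [ v ≟ w ]· h v

∑-reindex : ∀ {m n} (e : Fin m → Fin n) → (∀ {a b} → e a ≡ e b → a ≡ b) →
  (h : Fin n → ℕ) → (∀ v → h v ≡ 0 ⊎ ∃ λ b → e b ≡ v) → sum h ≡ sum (h ∘ e)
∑-reindex e e-injective h support = begin
  sum h                                      ≡⟨ sum-cong-≗ spread ⟩
  sum (λ v → sum (λ b → [ v ≟ e b ]· h v))  ≡⟨ ∑-comm (λ v b → [ v ≟ e b ]· h v) ⟩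
  sum (λ b → sum (λ v → [ v ≟ e b ]· h v))  ≡⟨ sum-cong-≗ (λ b → ∑-single (e b) h) ⟩
  sum (h ∘ e)                                ∎
  where
  open ≡-Reasoning
  spread : ∀ v → h v ≡ sum (λ b → [ v ≟ e b ]· h v)
  spread v with support v
  ... | inj₁ hv≡0 rewrite hv≡0 = sym (∑-zero (λ b → [≟]·-zero v (e b)))
  ... | inj₂ (b₀ , refl) = sym (begin
    sum (λ b → [ e b₀ ≟ e b ]· h (e b₀))  ≡⟨ sum-cong-≗ reflect ⟩
    sum (λ b → [ b ≟ b₀ ]· h (e b₀))      ≡⟨ ∑-single b₀ (λ _ → h (e b₀)) ⟩
    h (e b₀)                               ∎)
    where
    reflect : ∀ b → [ e b₀ ≟ e b ]· h (e b₀) ≡ [ b ≟ b₀ ]· h (e b₀)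
    reflect b with e b₀ ≟ e b | b ≟ b₀
    ... | yes _  | yes _    = refl
    ... | no _   | no _     = refl
    ... | yes eq | no b≢b₀  = ⊥-elim (b≢b₀ (sym (e-injective eq)))
    ... | no neq | yes refl = ⊥-elim (neq refl)

listSum-tabulate : ∀ {n} (f : Fin n → ℕ) → ListAction.sum (tabulate f) ≡ sum f
listSum-tabulate {zero}  f = refl
listSum-tabulate {suc n} f = cong (f zero +_) (listSum-tabulate (f ∘ suc))

degree≡∑ : ∀ {n} (G : Graph n) v → degree G v ≡ sum (λ u → 𝟙 (adj G v u))
degree≡∑ {n} G v = trans (cong ListAction.sum (map-tabulate id (𝟙 ∘ adj G v))) (listSum-tabulate (𝟙 ∘ adj G v))

restricted-degree : ∀ {n} (G H : Graph n) u (R : Fin n → Bool) → degree H u ≡ degree G u →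
  (∀ v → R v ≡ false → adj H u v ≡ adj G u v) →
  sum (λ v → 𝟙 (R v ∧ adj H u v)) ≡ sum (λ v → 𝟙 (R v ∧ adj G u v))
restricted-degree {n} G H u R same agree = +-cancelʳ-≡ (outside G) (inside H) (inside G) (begin
  inside H + outside G          ≡⟨ cong (inside H +_) (sum-cong-≗ outside-same) ⟨
  inside H + outside H          ≡⟨ split H ⟨
  sum (λ v → 𝟙 (adj H u v))     ≡⟨ degree≡∑ H u ⟨
  degree H u                    ≡⟨ same ⟩
  degree G u                    ≡⟨ degree≡∑ G u ⟩
  sum (λ v → 𝟙 (adj G u v))     ≡⟨ split G ⟩
  inside G + outside G          ∎)
  where
  open ≡-Reasoning
  inside outside : Graph n → ℕ
  inside  X = sum (λ v → 𝟙 (R v ∧ adj X u v))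
  outside X = sum (λ v → 𝟙 (not (R v) ∧ adj X u v))
  split : ∀ X → sum (λ v → 𝟙 (adj X u v)) ≡ inside X + outside X
  split X = trans (sum-cong-≗ (λ v → 𝟙-split true (R v) (adj X u v)))
                  (∑-distrib-+ (λ v → 𝟙 (R v ∧ adj X u v)) (λ v → 𝟙 (not (R v) ∧ adj X u v)))
  outside-same : ∀ v → 𝟙 (not (R v) ∧ adj H u v) ≡ 𝟙 (not (R v) ∧ adj G u v)
  outside-same v with R v in Rv
  ... | true  = refl
  ... | false = cong 𝟙 (agree v Rv)

to-injective : ∀ {A B : Set} (π : A ↔ B) {x y} → to π x ≡ to π y → x ≡ y
to-injective π {x} {y} eq =
  trans (sym (strictlyInverseʳ π x)) (trans (cong (from π) eq) (strictlyInverseʳ π y))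

Antimorphism : ∀ {A : Set} → (A → A → Bool) → (A → A) → Set
Antimorphism a σ = ∀ u v → u ≢ v → a u v ≡ not (a (σ u) (σ v))

adj-complement : ∀ {n} (H : Graph n) {u v} → u ≢ v → adj (complement H) u v ≡ not (adj H u v)
adj-complement H {u} {v} u≢v with u ≟ v
... | yes u≡v = ⊥-elim (u≢v u≡v)
... | no _    = refl

antimorphism⇒selfComplementary : ∀ {n} (H : Graph n) (σ : Fin n ↔ Fin n) →
  Antimorphism (adj H) (to σ) → SelfComplementary H
antimorphism⇒selfComplementary H σ anti = σ , preserves
  where
  preserves : ∀ u v → adj H u v ≡ adj (complement H) (to σ u) (to σ v)
  preserves u v with u ≟ v
  ... | yes refl = trans (irrefl H u) (sym (irrefl (complement H) (to σ u)))
  ... | no u≢v   = trans (anti u v u≢v) (sym (adj-complement H (u≢v ∘ to-injective σ)))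

conjugate : ∀ {A B : Set} → B ↔ A → A ↔ A → B ↔ B
conjugate ψ σ = ↔-trans ψ (↔-trans σ (↔-sym ψ))

antimorphism-conjugate : ∀ {A B : Set} (a : B → B → Bool) (ψ : B ↔ A) (σ : A ↔ A) →
  Antimorphism (λ x y → a (from ψ x) (from ψ y)) (to σ) → Antimorphism a (to (conjugate ψ σ))
antimorphism-conjugate a ψ σ anti u v u≢v =
  trans (cong₂ a (sym (strictlyInverseʳ ψ u)) (sym (strictlyInverseʳ ψ v)))
        (anti (to ψ u) (to ψ v) (u≢v ∘ to-injective ψ))

relabel : ∀ {m n} → Graph m → Fin m ↔ Fin n → Graph n
relabel H π = record
  { adj    = λ u v → adj H (from π u) (from π v)
  ; sym    = λ u v → Graph.sym H (from π u) (from π v)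
  ; irrefl = λ v → irrefl H (from π v)
  }

degree-relabel : ∀ {m n} (H : Graph m) (π : Fin m ↔ Fin n) u →
  degree (relabel H π) u ≡ degree H (from π u)
degree-relabel H π u = begin
  degree (relabel H π) u                                ≡⟨ degree≡∑ (relabel H π) u ⟩
  sum (λ v → 𝟙 (adj H (from π u) (from π v)))          ≡⟨ ∑-permute _ π ⟩
  sum (λ w → 𝟙 (adj H (from π u) (from π (to π w))))   ≡⟨ sum-cong-≗ (λ w → cong (𝟙 ∘ adj H (from π u)) (strictlyInverseʳ π w)) ⟩
  sum (λ w → 𝟙 (adj H (from π u) w))                   ≡⟨ degree≡∑ H (from π u) ⟨
  degree H (from π u)                                   ∎
  where open ≡-Reasoning

cast-↔ : ∀ {m n} → .(m ≡ n) → Fin m ↔ Fin n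
cast-↔ eq = mk↔ₛ′ (cast eq) (cast (sym eq)) (cast-involutive eq (sym eq)) (cast-involutive (sym eq) eq)

tabulate-↭⇒↔ : ∀ {m n} (f : Fin m → ℕ) (g : Fin n → ℕ) → tabulate f ↭ tabulate g →
  Σ (Fin m ↔ Fin n) λ π → ∀ i → f i ≡ g (to π i)
tabulate-↭⇒↔ {m} {n} f g f↭g = ↔-trans (cast-↔ (sym (length-tabulate f))) (↔-trans ρ (cast-↔ (length-tabulate g))) , agree
  where
  open ≡-Reasoning
  ρ : Fin (length (tabulate f)) ↔ Fin (length (tabulate g))
  ρ = onIndices (↭⇒↭ₛ f↭g)
  agree : ∀ i → f i ≡ g (cast (length-tabulate g) (to ρ (cast (sym (length-tabulate f)) i)))
  agree i = begin
    f i                                   ≡⟨ lookup-tabulate f i ⟨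
    lookup (tabulate f) i′                ≡⟨ onIndices-lookup (↭⇒↭ₛ f↭g) i′ ⟩
    lookup (tabulate g) j                 ≡⟨ cong (lookup (tabulate g)) (cast-involutive (sym lg) lg j) ⟨
    lookup (tabulate g) (cast (sym lg) (cast lg j)) ≡⟨ lookup-tabulate g (cast lg j) ⟩
    g (cast lg j)                         ∎
    where
    lg : length (tabulate g) ≡ n
    lg = length-tabulate g
    i′ : Fin (length (tabulate f))
    i′ = cast (sym (length-tabulate f)) i
    j : Fin (length (tabulate g))
    j = to ρ i′

degreeSequence-≡⇒↔ : ∀ {m n} (H : Graph m) (G : Graph n) → degreeSequence H ≡ degreeSequence G →
  Σ (Fin m ↔ Fin n) λ π → ∀ u → degree H u ≡ degree G (to π u)
degreeSequence-≡⇒↔ {m} {n} H G eq = tabulate-↭⇒↔ (degree H) (degree G) (begin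
  tabulate (degree H)                   ≡⟨ map-tabulate id (degree H) ⟨
  map (degree H) (allFin m)             ↭⟨ SortDesc.sort-↭ _ ⟨
  degreeSequence H                      ≡⟨ eq ⟩
  degreeSequence G                      ↭⟨ SortDesc.sort-↭ _ ⟩
  map (degree G) (allFin n)             ≡⟨ map-tabulate id (degree G) ⟩
  tabulate (degree G)                   ∎)
  where open PermutationReasoning

-- Degree-preserving graphs inherit complete and anticomplete pairs

∧-left-swap : ∀ p q x → p ∧ q ∧ x ≡ q ∧ p ∧ x
∧-left-swap false false x = refl
∧-left-swap false true  x = refl
∧-left-swap true  false x = refl
∧-left-swap true  true  x = refl

module DegreeRigidity {n} (G H : Graph n) (same-degree : ∀ u → degree H u ≡ degree G u)
  (A B : Fin n → Bool)
  (A-complete : ∀ u v → A u ≡ true → B v ≡ false → u ≢ v → adj G u v ≡ true)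
  (B-anticomplete : ∀ u v → B u ≡ true → A v ≡ false → adj G u v ≡ false) where

  edges : Graph n → (Fin n → Bool) → (Fin n → Bool) → ℕ
  edges X P Q = sum (λ u → sum (λ v → 𝟙 (P u ∧ Q v ∧ adj X u v)))

  degreeSum : Graph n → (Fin n → Bool) → ℕ
  degreeSum X P = sum (λ u → sum (λ v → 𝟙 (P u ∧ adj X u v)))

  degreeSum-split : ∀ X P Q → degreeSum X P ≡ edges X P Q + edges X P (not ∘ Q)
  degreeSum-split X P Q = trans (sum-cong-≗ split-at) (∑-distrib-+ (λ u → sum (λ v → 𝟙 (P u ∧ Q v ∧ adj X u v)))
                                                                  (λ u → sum (λ v → 𝟙 (P u ∧ not (Q v) ∧ adj X u v))))
    where
    split-at : ∀ u → sum (λ v → 𝟙 (P u ∧ adj X u v)) ≡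
      sum (λ v → 𝟙 (P u ∧ Q v ∧ adj X u v)) + sum (λ v → 𝟙 (P u ∧ not (Q v) ∧ adj X u v))
    split-at u = trans (sum-cong-≗ (λ v → 𝟙-split (P u) (Q v) (adj X u v)))
                       (∑-distrib-+ (λ v → 𝟙 (P u ∧ Q v ∧ adj X u v)) (λ v → 𝟙 (P u ∧ not (Q v) ∧ adj X u v)))

  degreeSum-same : ∀ P → degreeSum H P ≡ degreeSum G P
  degreeSum-same P = sum-cong-≗ at
    where
    at : ∀ u → sum (λ v → 𝟙 (P u ∧ adj H u v)) ≡ sum (λ v → 𝟙 (P u ∧ adj G u v))
    at u with P u
    ... | false = refl
    ... | true  = trans (sym (degree≡∑ H u)) (trans (same-degree u) (degree≡∑ G u))

  edges-comm : ∀ X P Q → edges X P Q ≡ edges X Q P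
  edges-comm X P Q = trans (∑-comm (λ u v → 𝟙 (P u ∧ Q v ∧ adj X u v))) (sum-cong-≗ λ v → sum-cong-≗ λ u →
    cong 𝟙 (trans (∧-left-swap (P u) (Q v) (adj X u v)) (cong (λ e → Q v ∧ P u ∧ e) (Graph.sym X u v))))

  A-to-Bᶜ-≤ : ∀ u v → 𝟙 (A u ∧ not (B v) ∧ adj H u v) ≤ 𝟙 (A u ∧ not (B v) ∧ adj G u v)
  A-to-Bᶜ-≤ u v with A u in Au | B v in Bv | u ≟ v
  ... | false | _     | _        = z≤n
  ... | true  | true  | _        = z≤n
  ... | true  | false | yes refl rewrite irrefl H u = z≤n
  ... | true  | false | no u≢v  rewrite A-complete u v Au Bv u≢v = 𝟙≤1 (adj H u v)

  B-to-Aᶜ-in-G : edges G B (not ∘ A) ≡ 0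
  B-to-Aᶜ-in-G = ∑-zero λ u → ∑-zero λ v → at u v
    where
    at : ∀ u v → 𝟙 (B u ∧ not (A v) ∧ adj G u v) ≡ 0
    at u v with B u in Bu | A v in Av
    ... | false | _     = refl
    ... | true  | true  = refl
    ... | true  | false rewrite B-anticomplete u v Bu Av = refl

  private
    a b c a′ b′ : ℕ
    a  = edges H A (not ∘ B)
    b  = edges H A B
    c  = edges H B (not ∘ A)
    a′ = edges G A (not ∘ B)
    b′ = edges G A B

    a≤a′ : a ≤ a′
    a≤a′ = ∑-mono-≤ λ u → ∑-mono-≤ λ v → A-to-Bᶜ-≤ u v

    a+b≡a′+b′ : a + b ≡ a′ + b′
    a+b≡a′+b′ = begin
      a + b        ≡⟨ +-comm a b ⟩
      b + a        ≡⟨ degreeSum-split H A B ⟨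
      degreeSum H A ≡⟨ degreeSum-same A ⟩
      degreeSum G A ≡⟨ degreeSum-split G A B ⟩
      b′ + a′      ≡⟨ +-comm b′ a′ ⟩
      a′ + b′      ∎
      where open ≡-Reasoning

    b+c≡b′ : b + c ≡ b′
    b+c≡b′ = begin
      b + c                          ≡⟨ cong (_+ c) (edges-comm H A B) ⟩
      edges H B A + c                ≡⟨ degreeSum-split H B A ⟨
      degreeSum H B                  ≡⟨ degreeSum-same B ⟩
      degreeSum G B                  ≡⟨ degreeSum-split G B A ⟩
      edges G B A + edges G B (not ∘ A) ≡⟨ cong₂ _+_ (edges-comm G B A) B-to-Aᶜ-in-G ⟩
      b′ + 0                         ≡⟨ +-identityʳ b′ ⟩
      b′                             ∎
      where open ≡-Reasoning

    -- a + b = a′ + b + c together with a ≤ a′ forces a = a′ and c = 0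
    a′+c≡a : a′ + c ≡ a
    a′+c≡a = +-cancelʳ-≡ b (a′ + c) a (begin
      a′ + c + b   ≡⟨ +-assoc a′ c b ⟩
      a′ + (c + b) ≡⟨ cong (a′ +_) (trans (+-comm c b) b+c≡b′) ⟩
      a′ + b′      ≡⟨ a+b≡a′+b′ ⟨
      a + b        ∎)
      where open ≡-Reasoning

    c≡0 : c ≡ 0
    c≡0 = n≤0⇒n≡0 (+-cancelˡ-≤ a′ c 0 (begin
      a′ + c ≡⟨ a′+c≡a ⟩
      a      ≤⟨ a≤a′ ⟩
      a′     ≡⟨ +-identityʳ a′ ⟨
      a′ + 0 ∎))
      where open ≤-Reasoning

    a≡a′ : a ≡ a′
    a≡a′ = trans (sym a′+c≡a) (trans (cong (a′ +_) c≡0) (+-identityʳ a′))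

  A-complete-in-H : ∀ u v → A u ≡ true → B v ≡ false → u ≢ v → adj H u v ≡ true
  A-complete-in-H u v Au Bv u≢v = 𝟙-injective (begin
    𝟙 (adj H u v)                        ≡⟨ cong₂ (λ p q → 𝟙 (p ∧ not q ∧ adj H u v)) Au Bv ⟨
    𝟙 (A u ∧ not (B v) ∧ adj H u v)      ≡⟨ tight ⟩
    𝟙 (A u ∧ not (B v) ∧ adj G u v)      ≡⟨ cong₂ (λ p q → 𝟙 (p ∧ not q ∧ adj G u v)) Au Bv ⟩
    𝟙 (adj G u v)                        ≡⟨ cong 𝟙 (A-complete u v Au Bv u≢v) ⟩
    𝟙 true                               ∎)
    where
    open ≡-Reasoning
    tight : 𝟙 (A u ∧ not (B v) ∧ adj H u v) ≡ 𝟙 (A u ∧ not (B v) ∧ adj G u v)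
    tight = ∑-mono-≤-tight (A-to-Bᶜ-≤ u)
              (∑-mono-≤-tight (λ u → ∑-mono-≤ (A-to-Bᶜ-≤ u)) a≡a′ u) v

  B-anticomplete-in-H : ∀ u v → B u ≡ true → A v ≡ false → adj H u v ≡ false
  B-anticomplete-in-H u v Bu Av = 𝟙-injective (begin
    𝟙 (adj H u v)                        ≡⟨ cong₂ (λ p q → 𝟙 (p ∧ not q ∧ adj H u v)) Bu Av ⟨
    𝟙 (B u ∧ not (A v) ∧ adj H u v)      ≡⟨ ∑≡0⇒≡0 (∑≡0⇒≡0 c≡0 u) v ⟩
    0                                    ∎)
    where open ≡-Reasoning

-- Exhaustive search

_==_ : ∀ {n} → Fin n → Fin n → Bool
a == b = does (a ≟ b)

==-sound : ∀ {n} {a b : Fin n} → (a == b) ≡ true → a ≡ b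
==-sound {a = a} {b} eq with a ≟ b
... | yes a≡b = a≡b

==-refl : ∀ {n} (a : Fin n) → (a == a) ≡ true
==-refl a with a ≟ a
... | yes _   = refl
... | no a≢a = ⊥-elim (a≢a refl)

==-≢ : ∀ {n} {a b : Fin n} → a ≢ b → (a == b) ≡ false
==-≢ {a = a} {b} a≢b with a ≟ b
... | yes a≡b = ⊥-elim (a≢b a≡b)
... | no _    = refl

≡-or-≢ : ∀ {n} (a b : Fin n) → a ≡ b ⊎ a ≢ b
≡-or-≢ a b with a ≟ b
... | yes a≡b = inj₁ a≡b
... | no a≢b  = inj₂ a≢b

not-true : ∀ {x} → not x ≡ true → x ≡ false
not-true {false} _ = refl

not-false : ∀ {x} → not x ≡ false → x ≡ true
not-false {true} _ = refl

xor-sound : ∀ x y → x xor y ≡ true → x ≡ not y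
xor-sound true  false _ = refl
xor-sound false true  _ = refl

not-xor-complete : ∀ {x y} → x ≡ y → not (x xor y) ≡ true
not-xor-complete {true}  refl = refl
not-xor-complete {false} refl = refl

≡ᵇ-complete : ∀ {m n} → m ≡ n → (m ≡ᵇ n) ≡ true
≡ᵇ-complete {m} refl = Equivalence.to T-≡ (≡⇒≡ᵇ m m refl)

<ᵇ-true⇒< : ∀ {m n} → (m <ᵇ n) ≡ true → m < n
<ᵇ-true⇒< {m} {n} e = <ᵇ⇒< m n (Equivalence.from T-≡ e)

<⇒<ᵇ-true : ∀ {m n} → m < n → (m <ᵇ n) ≡ true
<⇒<ᵇ-true m<n = Equivalence.to T-≡ (<⇒<ᵇ m<n)

≤⇒<ᵇ-false : ∀ {m n} → n ≤ m → (m <ᵇ n) ≡ false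
≤⇒<ᵇ-false {m} {n} n≤m with m <ᵇ n in e
... | false = refl
... | true  = ⊥-elim (<⇒≱ (<ᵇ-true⇒< e) n≤m)

<ᵇ-false⇒≤ : ∀ {m n} → (m <ᵇ n) ≡ false → n ≤ m
<ᵇ-false⇒≤ e = ≮⇒≥ λ m<n → case trans (sym (<⇒<ᵇ-true m<n)) e of λ ()

<ᵇ-flip : ∀ {m n} → m ≢ n → (n <ᵇ m) ≡ not (m <ᵇ n)
<ᵇ-flip {m} {n} m≢n with m <ᵇ n in e
... | true  = ≤⇒<ᵇ-false {n} {m} (<⇒≤ (<ᵇ-true⇒< e))
... | false = <⇒<ᵇ-true (≤∧≢⇒< (<ᵇ-false⇒≤ e) (m≢n ∘ sym))

every : ∀ {n} → (Fin n → Bool) → Bool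
every {zero}  p = true
every {suc n} p = p zero ∧ every (p ∘ suc)

every-sound : ∀ {n} {p : Fin n → Bool} → every p ≡ true → ∀ i → p i ≡ true
every-sound {suc n} {p} all zero    = ∧-conicalˡ (p zero) _ all
every-sound {suc n} {p} all (suc i) = every-sound (∧-conicalʳ (p zero) _ all) i

every-complete : ∀ {n} {p : Fin n → Bool} → (∀ i → p i ≡ true) → every p ≡ true
every-complete {zero}  _   = refl
every-complete {suc n} all rewrite all zero = every-complete (all ∘ suc)

Matches : ∀ {h} → (Fin h → Maybe Bool) → Vec Bool h → Set
Matches m r = ∀ b {x} → m b ≡ just x → Vec.lookup r b ≡ x

mutual
  everyMatching : ∀ {h} → (Fin h → Maybe Bool) → (Vec Bool h → Bool) → Bool
  everyMatching {zero}  m P = P []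
  everyMatching {suc h} m P = everyMatchingFrom (m zero) (m ∘ suc) P

  everyMatchingFrom : ∀ {h} → Maybe Bool → (Fin h → Maybe Bool) → (Vec Bool (suc h) → Bool) → Bool
  everyMatchingFrom (just x) m P = everyMatching m (λ v → P (x ∷ v))
  everyMatchingFrom nothing  m P = everyMatching m (λ v → P (true ∷ v)) ∧ everyMatching m (λ v → P (false ∷ v))

mutual
  everyMatching-sound : ∀ {h} (m : Fin h → Maybe Bool) {P} → everyMatching m P ≡ true →
    ∀ r → Matches m r → P r ≡ true
  everyMatching-sound {zero}  m all []      _       = all
  everyMatching-sound {suc h} m all (x ∷ r) matches =
    everyMatchingFrom-sound (m zero) (m ∘ suc) all x r (matches zero) (matches ∘ suc)

  everyMatchingFrom-sound : ∀ {h} mx (m : Fin h → Maybe Bool) {P} → everyMatchingFrom mx m P ≡ true →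
    ∀ x r → (∀ {y} → mx ≡ just y → x ≡ y) → Matches m r → P (x ∷ r) ≡ true
  everyMatchingFrom-sound (just y) m all x r head tail rewrite head refl = everyMatching-sound m all r tail
  everyMatchingFrom-sound nothing  m all true  r _ tail = everyMatching-sound m (∧-conicalˡ _ _ all) r tail
  everyMatchingFrom-sound nothing  m all false r _ tail = everyMatching-sound m (∧-conicalʳ _ _ all) r tail

everyMatrix : ∀ {h k} → (Fin k → Fin h → Maybe Bool) → (Fin k → Vec Bool h → Bool) →
  (Vec (Vec Bool h) k → Bool) → Bool
everyMatrix {k = zero}  mask rowOK P = P []
everyMatrix {k = suc k} mask rowOK P = everyMatching (mask zero) λ r →
  not (rowOK zero r) ∨ everyMatrix (mask ∘ suc) (rowOK ∘ suc) (λ R → P (r ∷ R))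

everyMatrix-sound : ∀ {h k} mask (rowOK : Fin k → Vec Bool h → Bool) {P} → everyMatrix mask rowOK P ≡ true →
  ∀ R → (∀ i → Matches (mask i) (Vec.lookup R i)) → (∀ i → rowOK i (Vec.lookup R i) ≡ true) → P R ≡ true
everyMatrix-sound {k = zero}  mask rowOK all []      _       _  = all
everyMatrix-sound {k = suc k} mask rowOK all (r ∷ R) matches ok
  with everyMatching-sound (mask zero) all r (matches zero)
... | rest rewrite ok zero = everyMatrix-sound (mask ∘ suc) (rowOK ∘ suc) rest R (matches ∘ suc) (ok ∘ suc)

any-witness : ∀ {A : Set} (p : A → Bool) xs → any p xs ≡ true → Σ A λ x → p x ≡ true
any-witness p (x ∷ xs) found with p x in px
... | true  = x , px
... | false = any-witness p xs found

count : ∀ {h} → Vec Bool h → ℕ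
count r = sum (𝟙 ∘ Vec.lookup r)

antimorphism? : ∀ {s} → (Fin s → Fin s → Bool) → (Fin s → Fin s) → Bool
antimorphism? L σ = every λ a → every λ b → (a == b) ∨ (L a b xor L (σ a) (σ b))

antimorphism?-sound : ∀ {s} (L : Fin s → Fin s → Bool) σ → antimorphism? L σ ≡ true → Antimorphism L σ
antimorphism?-sound L σ ok a b a≢b =
  xor-sound _ _ (subst (λ e → e ∨ _ ≡ true) (==-≢ a≢b) (every-sound (every-sound ok a) b))

-- The cycles of an antimorphism have lengths divisible by 4, apart from at most one fixed point;
-- the search only uses antimorphisms with σ⁴ = id, whose inverse is then σ³.
order4? : ∀ {s} → (Fin s → Fin s) → Bool
order4? σ = every λ a → σ (σ (σ (σ a))) == a

order4⇒↔ : ∀ {s} (σ : Fin s → Fin s) → order4? σ ≡ true → Fin s ↔ Fin s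
order4⇒↔ σ ok = mk↔ₛ′ σ (σ ∘ σ ∘ σ) σ⁴≡id σ⁴≡id
  where
  σ⁴≡id : ∀ a → σ (σ (σ (σ a))) ≡ a
  σ⁴≡id a = ==-sound (every-sound ok a)

localAdj-clique? : Kind → Bool
localAdj-clique? k = every λ a → every λ b →
  not (inClique k a) ∨ not (inClique k b) ∨ (a == b) ∨ localAdj k a b

localAdj-independent? : Kind → Bool
localAdj-independent? k = every λ a → every λ b →
  inClique k a ∨ inClique k b ∨ not (localAdj k a b)

localAdj-clique?-holds : ∀ k → localAdj-clique? k ≡ true
localAdj-clique?-holds P4 = refl
localAdj-clique?-holds A8 = refl
localAdj-clique?-holds B8 = refl

localAdj-independent?-holds : ∀ k → localAdj-independent? k ≡ true
localAdj-independent?-holds P4 = refl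
localAdj-independent?-holds A8 = refl
localAdj-independent?-holds B8 = refl

localAdj-clique : ∀ k {a b} → inClique k a ≡ true → inClique k b ≡ true → a ≢ b → localAdj k a b ≡ true
localAdj-clique k {a} {b} ka kb a≢b
  with every-sound (every-sound (localAdj-clique?-holds k) a) b
... | ok rewrite ka | kb | ==-≢ a≢b = ok

localAdj-independent : ∀ k {a b} → inClique k a ≡ false → inClique k b ≡ false → localAdj k a b ≡ false
localAdj-independent k {a} {b} ka kb
  with every-sound (every-sound (localAdj-independent?-holds k) a) b
... | ok rewrite ka | kb = trans (sym (not-involutive _)) (cong not ok)

-- Found by a computer search: for each of the 90 graphs on eight vertices with K = {0,1,2,3} a clique
-- of degree 5 and I = {4,5,6,7} an independent set of degree 2, one of these is an antimorphism.
eightVertexCandidates : List (Vec (Fin 8) 8)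
eightVertexCandidates =
    (# 4 ∷ # 5 ∷ # 6 ∷ # 7 ∷ # 1 ∷ # 0 ∷ # 3 ∷ # 2 ∷ [])
  ∷ (# 4 ∷ # 5 ∷ # 7 ∷ # 6 ∷ # 1 ∷ # 0 ∷ # 2 ∷ # 3 ∷ [])
  ∷ (# 4 ∷ # 6 ∷ # 5 ∷ # 7 ∷ # 3 ∷ # 1 ∷ # 2 ∷ # 0 ∷ [])
  ∷ (# 4 ∷ # 7 ∷ # 6 ∷ # 5 ∷ # 2 ∷ # 1 ∷ # 0 ∷ # 3 ∷ [])
  ∷ (# 4 ∷ # 5 ∷ # 6 ∷ # 7 ∷ # 2 ∷ # 3 ∷ # 0 ∷ # 1 ∷ [])
  ∷ (# 4 ∷ # 5 ∷ # 6 ∷ # 7 ∷ # 3 ∷ # 2 ∷ # 1 ∷ # 0 ∷ [])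
  ∷ (# 4 ∷ # 5 ∷ # 7 ∷ # 6 ∷ # 2 ∷ # 3 ∷ # 1 ∷ # 0 ∷ [])
  ∷ (# 4 ∷ # 5 ∷ # 7 ∷ # 6 ∷ # 3 ∷ # 2 ∷ # 0 ∷ # 1 ∷ [])
  ∷ (# 4 ∷ # 6 ∷ # 5 ∷ # 7 ∷ # 1 ∷ # 3 ∷ # 0 ∷ # 2 ∷ [])
  ∷ (# 4 ∷ # 6 ∷ # 5 ∷ # 7 ∷ # 2 ∷ # 0 ∷ # 3 ∷ # 1 ∷ [])
  ∷ (# 4 ∷ # 6 ∷ # 7 ∷ # 5 ∷ # 1 ∷ # 2 ∷ # 0 ∷ # 3 ∷ [])
  ∷ (# 4 ∷ # 6 ∷ # 7 ∷ # 5 ∷ # 2 ∷ # 1 ∷ # 3 ∷ # 0 ∷ [])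
  ∷ (# 4 ∷ # 6 ∷ # 7 ∷ # 5 ∷ # 3 ∷ # 0 ∷ # 2 ∷ # 1 ∷ [])
  ∷ (# 4 ∷ # 7 ∷ # 5 ∷ # 6 ∷ # 1 ∷ # 3 ∷ # 2 ∷ # 0 ∷ [])
  ∷ (# 4 ∷ # 7 ∷ # 5 ∷ # 6 ∷ # 2 ∷ # 0 ∷ # 1 ∷ # 3 ∷ [])
  ∷ (# 4 ∷ # 7 ∷ # 5 ∷ # 6 ∷ # 3 ∷ # 1 ∷ # 0 ∷ # 2 ∷ [])
  ∷ (# 4 ∷ # 7 ∷ # 6 ∷ # 5 ∷ # 1 ∷ # 2 ∷ # 3 ∷ # 0 ∷ [])
  ∷ (# 4 ∷ # 7 ∷ # 6 ∷ # 5 ∷ # 3 ∷ # 0 ∷ # 1 ∷ # 2 ∷ [])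
  ∷ []

blockCandidates : (k : Kind) → List (Vec (Fin (size k)) (size k))
blockCandidates P4 = (# 1 ∷ # 3 ∷ # 0 ∷ # 2 ∷ []) ∷ []
blockCandidates A8 = eightVertexCandidates
blockCandidates B8 = eightVertexCandidates

module BlockCertificate (k : Kind) where

  localDegree : Fin (size k) → ℕ
  localDegree a = sum (λ b → 𝟙 (localAdj k a b))

  -- A local graph is encoded by its rows.  A clique row is forced to be 1 at the other clique
  -- vertices and 0 on the diagonal; an independent row is forced to be 0 and is read off the
  -- clique rows by symmetry (fromRows), so only the K × I entries are enumerated.
  maskAt : Bool → Bool → Bool → Maybe Bool
  maskAt true  true  a≡b = just (not a≡b)
  maskAt true  false _   = nothing
  maskAt false _     _   = just false

  mask : Fin (size k) → Fin (size k) → Maybe Bool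
  mask a b = maskAt (inClique k a) (inClique k b) (a == b)

  rowCheck : Bool → Fin (size k) → Vec Bool (size k) → Bool
  rowCheck true  a r = count r ≡ᵇ localDegree a
  rowCheck false a r = true

  rowOK : Fin (size k) → Vec Bool (size k) → Bool
  rowOK a = rowCheck (inClique k a) a

  glue : Bool → Bool → Bool → Bool → Bool
  glue true  kb x y = x
  glue false kb x y = kb ∧ y

  fromRows : Vec (Vec Bool (size k)) (size k) → Fin (size k) → Fin (size k) → Bool
  fromRows R a b = glue (inClique k a) (inClique k b) (Vec.lookup (Vec.lookup R a) b) (Vec.lookup (Vec.lookup R b) a)

  degrees? : Vec (Vec Bool (size k)) (size k) → Bool
  degrees? R = every λ a → sum (λ b → 𝟙 (fromRows R a b)) ≡ᵇ localDegree a

  flips? : (Fin (size k) → Fin (size k)) → Bool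
  flips? σ = every λ a → inClique k (σ a) xor inClique k a

  good? : Vec (Vec Bool (size k)) (size k) → (Fin (size k) → Fin (size k)) → Bool
  good? R σ = order4? σ ∧ flips? σ ∧ antimorphism? (fromRows R) σ

  solvable? : Vec (Vec Bool (size k)) (size k) → Bool
  solvable? R = not (degrees? R) ∨ any (λ σ → good? R (Vec.lookup σ)) (blockCandidates k)

blockCertificates-valid : ∀ k →
  everyMatrix (BlockCertificate.mask k) (BlockCertificate.rowOK k) (BlockCertificate.solvable? k) ≡ true
blockCertificates-valid P4 = refl
blockCertificates-valid A8 = refl
blockCertificates-valid B8 = refl

BlockAntimorphism : (k : Kind) → (Fin (size k) → Fin (size k) → Bool) → Set
BlockAntimorphism k L = Σ (Fin (size k) ↔ Fin (size k)) λ σ →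
  (∀ a → inClique k (to σ a) ≡ not (inClique k a)) × Antimorphism L (to σ)

block-antimorphism : ∀ k (L : Fin (size k) → Fin (size k) → Bool) →
  (∀ a b → L a b ≡ L b a) → (∀ a → L a a ≡ false) →
  (∀ {a b} → inClique k a ≡ true → inClique k b ≡ true → a ≢ b → L a b ≡ true) →
  (∀ {a b} → inClique k a ≡ false → inClique k b ≡ false → L a b ≡ false) →
  (∀ a → sum (𝟙 ∘ L a) ≡ sum (λ b → 𝟙 (localAdj k a b))) →
  BlockAntimorphism k L
block-antimorphism k L L-sym L-irrefl L-clique L-independent L-degree =
  order4⇒↔ σ σ-order4 , flips , antimorphism
  where
  open BlockCertificate k

  R : Vec (Vec Bool (size k)) (size k)
  R = Vec.tabulate λ a → Vec.tabulate λ b → inClique k a ∧ L a b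

  entry : ∀ a b → Vec.lookup (Vec.lookup R a) b ≡ inClique k a ∧ L a b
  entry a b = trans (cong (λ r → Vec.lookup r b) (lookup∘tabulate _ a)) (lookup∘tabulate _ b)

  glue-L : ∀ a b → L a b ≡ glue (inClique k a) (inClique k b) (inClique k a ∧ L a b) (inClique k b ∧ L b a)
  glue-L a b with inClique k a in ka | inClique k b in kb
  ... | true  | _     = refl
  ... | false | true  = L-sym a b
  ... | false | false = L-independent ka kb

  L≗fromRows : ∀ a b → L a b ≡ fromRows R a b
  L≗fromRows a b = trans (glue-L a b) (sym (cong₂ (glue (inClique k a) (inClique k b)) (entry a b) (entry b a)))

  R-matches : ∀ a → Matches (mask a) (Vec.lookup R a)
  R-matches a b {x} = trans (entry a b) ∘ at
    where
    at : maskAt (inClique k a) (inClique k b) (a == b) ≡ just x → inClique k a ∧ L a b ≡ x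
    at with inClique k a in ka | inClique k b in kb | a ≟ b
    ... | true  | true  | yes refl = λ { refl → L-irrefl a }
    ... | true  | true  | no a≢b  = λ { refl → L-clique ka kb a≢b }
    ... | false | _     | _       = λ { refl → refl }

  R-rowOK : ∀ a → rowCheck (inClique k a) a (Vec.lookup R a) ≡ true
  R-rowOK a with inClique k a in ka
  ... | false = refl
  ... | true  = ≡ᵇ-complete (trans (sum-cong-≗ λ b → cong 𝟙 (trans (entry a b) (cong (_∧ L a b) ka)))
                                   (L-degree a))

  degrees-ok : degrees? R ≡ true
  degrees-ok = every-complete λ a →
    ≡ᵇ-complete (trans (sum-cong-≗ λ b → cong 𝟙 (sym (L≗fromRows a b))) (L-degree a))

  found : Σ (Vec (Fin (size k)) (size k)) λ σ → good? R (Vec.lookup σ) ≡ true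
  found = any-witness _ (blockCandidates k)
    (subst (λ d → not d ∨ any (λ σ → good? R (Vec.lookup σ)) (blockCandidates k) ≡ true) degrees-ok
      (everyMatrix-sound mask rowOK (blockCertificates-valid k) R R-matches R-rowOK))

  σ : Fin (size k) → Fin (size k)
  σ = Vec.lookup (proj₁ found)

  σ-order4 : order4? σ ≡ true
  σ-order4 = ∧-conicalˡ (order4? σ) _ (proj₂ found)

  σ-flips : flips? σ ≡ true
  σ-flips = ∧-conicalˡ (flips? σ) _ (∧-conicalʳ (order4? σ) _ (proj₂ found))

  σ-antimorphism : antimorphism? (fromRows R) σ ≡ true
  σ-antimorphism = ∧-conicalʳ (flips? σ) _ (∧-conicalʳ (order4? σ) _ (proj₂ found))

  flips : ∀ a → inClique k (σ a) ≡ not (inClique k a)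
  flips a = xor-sound _ _ (every-sound σ-flips a)

  antimorphism : Antimorphism L σ
  antimorphism a b a≢b = begin
    L a b                     ≡⟨ L≗fromRows a b ⟩
    fromRows R a b            ≡⟨ antimorphism?-sound (fromRows R) σ σ-antimorphism a b a≢b ⟩
    not (fromRows R (σ a) (σ b)) ≡⟨ cong not (L≗fromRows (σ a) (σ b)) ⟨
    not (L (σ a) (σ b))       ∎
    where open ≡-Reasoning

-- One of these is an antimorphism of each of the 12 labelled 5-cycles.
cycleCandidates : List (Vec (Fin 5) 5)
cycleCandidates =
    (# 0 ∷ # 2 ∷ # 3 ∷ # 4 ∷ # 1 ∷ [])
  ∷ (# 0 ∷ # 2 ∷ # 4 ∷ # 1 ∷ # 3 ∷ [])
  ∷ (# 0 ∷ # 3 ∷ # 4 ∷ # 2 ∷ # 1 ∷ [])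
  ∷ []

module CycleCertificate where

  maskAt : Bool → Maybe Bool
  maskAt true  = just false
  maskAt false = nothing

  mask : Fin 5 → Fin 5 → Maybe Bool
  mask a b = maskAt (a == b)

  rowOK : Fin 5 → Vec Bool 5 → Bool
  rowOK a r = count r ≡ᵇ sum (λ b → 𝟙 (cyc5 a b))

  entries : Vec (Vec Bool 5) 5 → Fin 5 → Fin 5 → Bool
  entries R a b = Vec.lookup (Vec.lookup R a) b

  symmetric? : Vec (Vec Bool 5) 5 → Bool
  symmetric? R = every λ a → every λ b → not (entries R a b xor entries R b a)

  good? : Vec (Vec Bool 5) 5 → (Fin 5 → Fin 5) → Bool
  good? R σ = order4? σ ∧ antimorphism? (entries R) σ

  solvable? : Vec (Vec Bool 5) 5 → Bool
  solvable? R = not (symmetric? R) ∨ any (λ σ → good? R (Vec.lookup σ)) cycleCandidates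

cycleCertificate-valid : everyMatrix CycleCertificate.mask CycleCertificate.rowOK CycleCertificate.solvable? ≡ true
cycleCertificate-valid = refl

cycle-antimorphism : ∀ c (L : Fin (csize c) → Fin (csize c) → Bool) →
  (∀ a b → L a b ≡ L b a) → (∀ a → L a a ≡ false) →
  (∀ a → sum (𝟙 ∘ L a) ≡ sum (λ b → 𝟙 (cAdj c a b))) →
  Σ (Fin (csize c) ↔ Fin (csize c)) λ σ → Antimorphism L (to σ)
cycle-antimorphism c0 L _ _ _ = ↔-refl , λ ()
cycle-antimorphism c1 L _ _ _ = ↔-refl , λ { zero zero 0≢0 → ⊥-elim (0≢0 refl) }
cycle-antimorphism c5 L L-sym L-irrefl L-degree = order4⇒↔ σ σ-order4 , antimorphism
  where
  open CycleCertificate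

  R : Vec (Vec Bool 5) 5
  R = Vec.tabulate (Vec.tabulate ∘ L)

  entry : ∀ a b → entries R a b ≡ L a b
  entry a b = trans (cong (λ r → Vec.lookup r b) (lookup∘tabulate (Vec.tabulate ∘ L) a)) (lookup∘tabulate (L a) b)

  R-matches : ∀ a → Matches (mask a) (Vec.lookup R a)
  R-matches a b {x} = trans (entry a b) ∘ at
    where
    at : maskAt (a == b) ≡ just x → L a b ≡ x
    at with a ≟ b
    ... | yes refl = λ { refl → L-irrefl a }
    ... | no _     = λ ()

  R-rowOK : ∀ a → rowOK a (Vec.lookup R a) ≡ true
  R-rowOK a = ≡ᵇ-complete (trans (sum-cong-≗ λ b → cong 𝟙 (entry a b)) (L-degree a))

  R-symmetric : symmetric? R ≡ true
  R-symmetric = every-complete λ a → every-complete λ b →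
    not-xor-complete (trans (entry a b) (trans (L-sym a b) (sym (entry b a))))

  found : Σ (Vec (Fin 5) 5) λ σ → good? R (Vec.lookup σ) ≡ true
  found = any-witness _ cycleCandidates
    (subst (λ d → not d ∨ any (λ σ → good? R (Vec.lookup σ)) cycleCandidates ≡ true) R-symmetric
      (everyMatrix-sound mask rowOK {P = solvable?} cycleCertificate-valid R R-matches R-rowOK))

  σ : Fin 5 → Fin 5
  σ = Vec.lookup (proj₁ found)

  σ-order4 : order4? σ ≡ true
  σ-order4 = ∧-conicalˡ (order4? σ) _ (proj₂ found)

  antimorphism : Antimorphism L σ
  antimorphism a b a≢b = begin
    L a b                         ≡⟨ entry a b ⟨
    entries R a b                 ≡⟨ antimorphism?-sound (entries R) σ (∧-conicalʳ (order4? σ) _ (proj₂ found)) a b a≢b ⟩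
    not (entries R (σ a) (σ b))   ≡⟨ cong not (entry (σ a) (σ b)) ⟩
    not (L (σ a) (σ b))           ∎
    where open ≡-Reasoning

crossAdj : Bool → Bool → Bool → Bool → Bool
crossAdj ka kb lt gt = (ka ∧ kb) ∨ (lt ∧ ka ∧ not kb) ∨ (gt ∧ kb ∧ not ka)

blockAdj-≢ : ∀ ts {i j} a b → i ≢ j → blockAdj ts i j a b ≡
  crossAdj (inClique (lookup ts i) a) (inClique (lookup ts j) b) (toℕ i <ᵇ toℕ j) (toℕ j <ᵇ toℕ i)
blockAdj-≢ ts {i} {j} a b i≢j with i ≟ j
... | yes i≡j = ⊥-elim (i≢j i≡j)
... | no _    = refl

blockAdj-same : ∀ ts i a b → blockAdj ts i i a b ≡ localAdj (lookup ts i) a b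
blockAdj-same ts i a b with i ≟ i
... | yes refl = refl
... | no i≢i  = ⊥-elim (i≢i refl)

outsideAdj : Bool → Bool → Bool → Bool
outsideAdj true  k≤ i≤ = not i≤
outsideAdj false k≤ i≤ = k≤

crossAdj≡outsideAdj : ∀ ka kb lt → crossAdj ka kb lt (not lt) ≡ outsideAdj ka (not lt ∧ kb) (not lt ∧ not kb)
crossAdj≡outsideAdj true  true  true  = refl
crossAdj≡outsideAdj true  true  false = refl
crossAdj≡outsideAdj true  false true  = refl
crossAdj≡outsideAdj true  false false = refl
crossAdj≡outsideAdj false true  true  = refl
crossAdj≡outsideAdj false true  false = refl
crossAdj≡outsideAdj false false true  = refl
crossAdj≡outsideAdj false false false = refl

outsideAdj-flip : ∀ ka k≤ i≤ → outsideAdj (not ka) i≤ k≤ ≡ not (outsideAdj ka k≤ i≤)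
outsideAdj-flip true  k≤ i≤ = sym (not-involutive i≤)
outsideAdj-flip false k≤ i≤ = refl

cyclePart : CSize → Part
cyclePart c0 = inK
cyclePart c1 = inK
cyclePart c5 = inC

cyclePart-inK-unique : ∀ c → cyclePart c ≡ inK → (x y : Fin (csize c)) → x ≡ y
cyclePart-inK-unique c1 _ zero zero = refl

cyclePart-≢inI : ∀ c → cyclePart c ≢ inI
cyclePart-≢inI c0 ()
cyclePart-≢inI c1 ()
cyclePart-≢inI c5 ()

cyclePart-cases : ∀ c → cyclePart c ≢ inC ⊎ c ≡ c5
cyclePart-cases c0 = inj₁ λ ()
cyclePart-cases c1 = inj₁ λ ()
cyclePart-cases c5 = inj₂ refl

blockPart : Bool → Part
blockPart k = if k then inK else inI

blockPart-inK : ∀ {k} → blockPart k ≡ inK → k ≡ true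
blockPart-inK {true} _ = refl

blockPart-inI : ∀ {k} → blockPart k ≡ inI → k ≡ false
blockPart-inI {false} _ = refl

blockPart-≢inC : ∀ k → blockPart k ≢ inC
blockPart-≢inC true  ()
blockPart-≢inC false ()

module Elementary {n} (ts : List Kind) (c : CSize) (φ : Fin n ↔ Vtx ts c) (G : Graph n)
  (G≅ : ∀ u v → adj G u v ≡ elemAdj ts c (to φ u) (to φ v)) where

  Block : Set
  Block = Fin (length ts)

  clique : (i : Block) → Fin (size (lookup ts i)) → Bool
  clique i = inClique (lookup ts i)

  E : Vtx ts c → Vtx ts c → Bool
  E = elemAdj ts c

  G-via-φ : ∀ x y → adj G (from φ x) (from φ y) ≡ E x y
  G-via-φ x y = trans (G≅ _ _) (cong₂ E (strictlyInverseˡ φ x) (strictlyInverseˡ φ y))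

  _≼_ : Block → Block → Bool
  j ≼ i = not (toℕ i <ᵇ toℕ j)

  ≼⇒≤ : ∀ {i j} → (j ≼ i) ≡ true → toℕ j ≤ toℕ i
  ≼⇒≤ j≼i = <ᵇ-false⇒≤ (not-true j≼i)

  ≤⇒≼ : ∀ {i j} → toℕ j ≤ toℕ i → (j ≼ i) ≡ true
  ≤⇒≼ j≤i = cong not (≤⇒<ᵇ-false j≤i)

  ≼-refl : ∀ i → (i ≼ i) ≡ true
  ≼-refl i = ≤⇒≼ {i} {i} ≤-refl

  ≼-trans : ∀ {i j l} → (l ≼ j) ≡ true → (j ≼ i) ≡ true → (l ≼ i) ≡ true
  ≼-trans {i} {j} {l} l≼j j≼i = ≤⇒≼ {i} {l} (≤-trans (≼⇒≤ {j} {l} l≼j) (≼⇒≤ {i} {j} j≼i))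

  ≼-strict : ∀ {i j} → (j ≼ i) ≡ true → i ≢ j → (i ≼ j) ≡ false
  ≼-strict {i} {j} j≼i i≢j =
    cong not (<⇒<ᵇ-true (≤∧≢⇒< (≼⇒≤ {i} {j} j≼i) (λ eq → i≢j (toℕ-injective (sym eq)))))

  K≤ I≤ : Block → Vtx ts c → Bool
  K≤ i (inj₁ (j , a)) = (j ≼ i) ∧ clique j a
  K≤ i (inj₂ _)       = false
  I≤ i (inj₁ (j , a)) = (j ≼ i) ∧ not (clique j a)
  I≤ i (inj₂ _)       = false

  inBlock : Block → Vtx ts c → Bool
  inBlock i (inj₁ (j , _)) = i == j
  inBlock i (inj₂ _)       = false

  K≤-self : ∀ {i a} → clique i a ≡ true → K≤ i (inj₁ (i , a)) ≡ true
  K≤-self {i} ka = cong₂ _∧_ (≼-refl i) ka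

  I≤-self : ∀ {i a} → clique i a ≡ false → I≤ i (inj₁ (i , a)) ≡ true
  I≤-self {i} ka = cong₂ _∧_ (≼-refl i) (cong not ka)

  K≤-antimono : ∀ {i j} y → (j ≼ i) ≡ true → K≤ i y ≡ false → K≤ j y ≡ false
  K≤-antimono (inj₂ _)       _   _   = refl
  K≤-antimono {j = j} (inj₁ (l , b)) j≼i Ki≡f with l ≼ j in l≼j | clique l b
  ... | false | _     = refl
  ... | true  | false = refl
  ... | true  | true  = case trans (sym (cong (_∧ true) (≼-trans {_} {j} {l} l≼j j≼i))) Ki≡f of λ ()

  I≤-antimono : ∀ {i j} y → (j ≼ i) ≡ true → I≤ i y ≡ false → I≤ j y ≡ false
  I≤-antimono (inj₂ _)       _   _   = refl
  I≤-antimono {j = j} (inj₁ (l , b)) j≼i Ii≡f with l ≼ j in l≼j | clique l b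
  ... | false | _     = refl
  ... | true  | true  = refl
  ... | true  | false = case trans (sym (cong (_∧ true) (≼-trans {_} {j} {l} l≼j j≼i))) Ii≡f of λ ()

  outside-block-≢ : ∀ {i j} {b : Fin (size (lookup ts j))} → inBlock i (inj₁ (j , b)) ≡ false → i ≢ j
  outside-block-≢ {i} out refl = case trans (sym (==-refl i)) out of λ ()

  outside-≢ : ∀ {i a} y → inBlock i y ≡ false → inj₁ (i , a) ≢ y
  outside-≢ {i} _ out refl = case trans (sym (==-refl i)) out of λ ()

  outsideAdj-none : ∀ ka → outsideAdj ka false false ≡ ka
  outsideAdj-none true  = refl
  outsideAdj-none false = refl

  E-outside : ∀ i a y → inBlock i y ≡ false → E (inj₁ (i , a)) y ≡ outsideAdj (clique i a) (K≤ i y) (I≤ i y)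
  E-outside i a (inj₂ _)       _   = sym (outsideAdj-none (clique i a))
  E-outside i a (inj₁ (j , b)) out = begin
    blockAdj ts i j a b                                     ≡⟨ blockAdj-≢ ts a b i≢j ⟩
    crossAdj (clique i a) (clique j b) lt (toℕ j <ᵇ toℕ i)  ≡⟨ cong (crossAdj (clique i a) (clique j b) lt) (<ᵇ-flip (i≢j ∘ toℕ-injective)) ⟩
    crossAdj (clique i a) (clique j b) lt (not lt)          ≡⟨ crossAdj≡outsideAdj (clique i a) (clique j b) lt ⟩
    outsideAdj (clique i a) (not lt ∧ clique j b) (not lt ∧ not (clique j b)) ∎
    where
    open ≡-Reasoning
    i≢j : i ≢ j
    i≢j = outside-block-≢ {i} {j} {b} out
    lt : Bool
    lt = toℕ i <ᵇ toℕ j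

  E-complete-outside : ∀ {i j a} y → K≤ i (inj₁ (j , a)) ≡ true → I≤ i y ≡ false → inBlock j y ≡ false →
    E (inj₁ (j , a)) y ≡ true
  E-complete-outside {i} {j} {a} y Kx Iy out = begin
    E (inj₁ (j , a)) y                         ≡⟨ E-outside j a y out ⟩
    outsideAdj (clique j a) (K≤ j y) (I≤ j y)  ≡⟨ cong₂ (λ ka i≤ → outsideAdj ka (K≤ j y) i≤) ka Ijy ⟩
    true                                       ∎
    where
    open ≡-Reasoning
    ka : clique j a ≡ true
    ka = ∧-conicalʳ (j ≼ i) _ Kx
    Ijy : I≤ j y ≡ false
    Ijy = I≤-antimono y (∧-conicalˡ (j ≼ i) _ Kx) Iy

  E-anticomplete-outside : ∀ {i j a} y → I≤ i (inj₁ (j , a)) ≡ true → K≤ i y ≡ false → inBlock j y ≡ false →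
    E (inj₁ (j , a)) y ≡ false
  E-anticomplete-outside {i} {j} {a} y Ix Ky out = begin
    E (inj₁ (j , a)) y                         ≡⟨ E-outside j a y out ⟩
    outsideAdj (clique j a) (K≤ j y) (I≤ j y)  ≡⟨ cong₂ (λ ka k≤ → outsideAdj ka k≤ (I≤ j y)) ka Kjy ⟩
    false                                      ∎
    where
    open ≡-Reasoning
    ka : clique j a ≡ false
    ka = not-true (∧-conicalʳ (j ≼ i) _ Ix)
    Kjy : K≤ j y ≡ false
    Kjy = K≤-antimono y (∧-conicalˡ (j ≼ i) _ Ix) Ky

  E-complete : ∀ i x y → K≤ i x ≡ true → I≤ i y ≡ false → x ≢ y → E x y ≡ true
  E-complete i (inj₁ (j , a)) (inj₂ z)       Kx Iy _   = E-complete-outside (inj₂ z) Kx Iy refl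
  E-complete i (inj₁ (j , a)) (inj₁ (l , b)) Kx Iy x≢y with ≡-or-≢ j l
  ... | inj₂ j≢l = E-complete-outside (inj₁ (l , b)) Kx Iy (==-≢ j≢l)
  ... | inj₁ refl = trans (blockAdj-same ts j a b)
                         (localAdj-clique (lookup ts j) (∧-conicalʳ (j ≼ i) _ Kx) kb (x≢y ∘ cong (λ b → inj₁ (j , b))))
    where
    kb : clique j b ≡ true
    kb = not-false (trans (sym (cong (_∧ not (clique j b)) (∧-conicalˡ (j ≼ i) _ Kx))) Iy)

  E-anticomplete : ∀ i x y → I≤ i x ≡ true → K≤ i y ≡ false → E x y ≡ false
  E-anticomplete i (inj₁ (j , a)) (inj₂ z)       Ix Ky = E-anticomplete-outside (inj₂ z) Ix Ky refl
  E-anticomplete i (inj₁ (j , a)) (inj₁ (l , b)) Ix Ky with ≡-or-≢ j l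
  ... | inj₂ j≢l = E-anticomplete-outside (inj₁ (l , b)) Ix Ky (==-≢ j≢l)
  ... | inj₁ refl = trans (blockAdj-same ts j a b)
                         (localAdj-independent (lookup ts j) (not-true (∧-conicalʳ (j ≼ i) _ Ix)) kb)
    where
    kb : clique j b ≡ false
    kb = trans (sym (cong (_∧ clique j b) (∧-conicalˡ (j ≼ i) _ Ix))) Ky

  part : Vtx ts c → Part
  part (inj₁ (i , a)) = blockPart (clique i a)
  part (inj₂ _)       = cyclePart c

  E-KK : ∀ x y → x ≢ y → part x ≡ inK → part y ≡ inK → E x y ≡ true
  E-KK (inj₁ (i , a)) y x≢y px py = E-complete i _ y (K≤-self (blockPart-inK px)) (I≤-of-K y py) x≢y
    where
    I≤-of-K : ∀ y → part y ≡ inK → I≤ i y ≡ false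
    I≤-of-K (inj₁ (j , b)) py = trans (cong (λ k → (j ≼ i) ∧ not k) (blockPart-inK py)) (∧-zeroʳ (j ≼ i))
    I≤-of-K (inj₂ _)       _  = refl
  E-KK (inj₂ x) (inj₁ (j , b)) _   _  py = blockPart-inK py
  E-KK (inj₂ x) (inj₂ y)       x≢y px _  = ⊥-elim (x≢y (cong inj₂ (cyclePart-inK-unique c px x y)))

  E-II : ∀ x y → part x ≡ inI → part y ≡ inI → E x y ≡ false
  E-II (inj₁ (i , a)) y px py = E-anticomplete i _ y (I≤-self (blockPart-inI px)) (K≤-of-I y py)
    where
    K≤-of-I : ∀ y → part y ≡ inI → K≤ i y ≡ false
    K≤-of-I (inj₁ (j , b)) py = trans (cong ((j ≼ i) ∧_) (blockPart-inI py)) (∧-zeroʳ (j ≼ i))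
    K≤-of-I (inj₂ _)       py = ⊥-elim (cyclePart-≢inI c py)
  E-II (inj₂ x) _ px _ = ⊥-elim (cyclePart-≢inI c px)

  E-CK : ∀ x y → part x ≡ inC → part y ≡ inK → E x y ≡ true
  E-CK (inj₁ (i , a)) _              px _  = ⊥-elim (blockPart-≢inC _ px)
  E-CK (inj₂ x)       (inj₁ (j , b)) _  py = blockPart-inK py
  E-CK (inj₂ x)       (inj₂ y)       px py = case trans (sym px) py of λ ()

  E-CI : ∀ x y → part x ≡ inC → part y ≡ inI → E x y ≡ false
  E-CI (inj₁ (i , a)) _              px _  = ⊥-elim (blockPart-≢inC _ px)
  E-CI (inj₂ x)       (inj₁ (j , b)) _  py = blockPart-inI py
  E-CI (inj₂ x)       (inj₂ y)       px py = case trans (sym px) py of λ ()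

  cycleC5 : (∀ v → part (to φ v) ≢ inC) ⊎ InducesC5 G (part ∘ to φ)
  cycleC5 with cyclePart-cases c
  ... | inj₁ c≢C = inj₁ λ v → no-C (to φ v)
    where
    no-C : ∀ x → part x ≢ inC
    no-C (inj₁ (i , a)) = blockPart-≢inC _
    no-C (inj₂ _)       = c≢C
  ... | inj₂ refl = inj₂ (g , g-injective , g-inC , g-onto , g-adj)
    where
    g : Fin 5 → Fin n
    g i = from φ (inj₂ i)
    g-injective : ∀ {i j} → g i ≡ g j → i ≡ j
    g-injective eq with to-injective (↔-sym φ) eq
    ... | refl = refl
    g-inC : ∀ i → part (to φ (g i)) ≡ inC
    g-inC i = cong part (strictlyInverseˡ φ (inj₂ i))
    g-onto : ∀ v → part (to φ v) ≡ inC → ∃ λ i → g i ≡ v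
    g-onto v pv with to φ v in eq
    ... | inj₁ (i , a) = ⊥-elim (blockPart-≢inC _ pv)
    ... | inj₂ x       = x , trans (cong (from φ) (sym eq)) (strictlyInverseʳ φ v)
    g-adj : ∀ i j → adj G (g i) (g j) ≡ cyc5 i j
    g-adj i j = G-via-φ (inj₂ i) (inj₂ j)

  pseudoSplit : PseudoSplit G
  pseudoSplit = part ∘ to φ
    , (λ u v u≢v pu pv → trans (G≅ u v) (E-KK (to φ u) (to φ v) (u≢v ∘ to-injective φ) pu pv))
    , (λ u v pu pv → trans (G≅ u v) (E-II (to φ u) (to φ v) pu pv))
    , (λ u v pu pv → trans (G≅ u v) (E-CK (to φ u) (to φ v) pu pv))
    , (λ u v pu pv → trans (G≅ u v) (E-CI (to φ u) (to φ v) pu pv))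
    , cycleC5

  module Realization (H : Graph n) (same-degree : ∀ u → degree H u ≡ degree G u) where

    h : Vtx ts c → Vtx ts c → Bool
    h x y = adj H (from φ x) (from φ y)

    h-sym : ∀ x y → h x y ≡ h y x
    h-sym x y = Graph.sym H (from φ x) (from φ y)

    module Rigid (i : Block) = DegreeRigidity G H same-degree (K≤ i ∘ to φ) (I≤ i ∘ to φ)
      (λ u v Ku Iv u≢v → trans (G≅ u v) (E-complete i (to φ u) (to φ v) Ku Iv (u≢v ∘ to-injective φ)))
      (λ u v Iu Kv → trans (G≅ u v) (E-anticomplete i (to φ u) (to φ v) Iu Kv))

    h-complete : ∀ i x y → K≤ i x ≡ true → I≤ i y ≡ false → x ≢ y → h x y ≡ true
    h-complete i x y Kx Iy x≢y = Rigid.A-complete-in-H i (from φ x) (from φ y)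
      (trans (cong (K≤ i) (strictlyInverseˡ φ x)) Kx) (trans (cong (I≤ i) (strictlyInverseˡ φ y)) Iy)
      (x≢y ∘ to-injective (↔-sym φ))

    h-anticomplete : ∀ i x y → I≤ i x ≡ true → K≤ i y ≡ false → h x y ≡ false
    h-anticomplete i x y Ix Ky = Rigid.B-anticomplete-in-H i (from φ x) (from φ y)
      (trans (cong (I≤ i) (strictlyInverseˡ φ x)) Ix) (trans (cong (K≤ i) (strictlyInverseˡ φ y)) Ky)

    -- If y lies on the opposite side of an earlier block, the edge is decided by y's own block.
    h-outside : ∀ i a y → inBlock i y ≡ false → h (inj₁ (i , a)) y ≡ outsideAdj (clique i a) (K≤ i y) (I≤ i y)
    h-outside i a (inj₂ z) _ with clique i a in ka
    ... | true  = h-complete i _ (inj₂ z) (K≤-self ka) refl λ ()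
    ... | false = h-anticomplete i _ (inj₂ z) (I≤-self ka) refl
    h-outside i a (inj₁ (j , b)) out with clique i a in ka
    ... | true with I≤ i (inj₁ (j , b)) in Iy
    ...   | false = h-complete i _ _ (K≤-self ka) Iy (outside-≢ _ out)
    ...   | true  = trans (h-sym _ _) (h-anticomplete j _ _ (I≤-self kb) (cong (_∧ clique i a) i⋠j))
      where
      i⋠j : (i ≼ j) ≡ false
      i⋠j = ≼-strict {i} {j} (∧-conicalˡ (j ≼ i) _ Iy) (outside-block-≢ {i} {j} {b} out)
      kb : clique j b ≡ false
      kb = not-true (∧-conicalʳ (j ≼ i) _ Iy)
    h-outside i a (inj₁ (j , b)) out | false with K≤ i (inj₁ (j , b)) in Ky
    ...   | false = h-anticomplete i _ _ (I≤-self ka) Ky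
    ...   | true  = trans (h-sym _ _)
                        (h-complete j _ _ (K≤-self kb) (cong (_∧ not (clique i a)) i⋠j) (outside-≢ _ out ∘ sym))
      where
      i⋠j : (i ≼ j) ≡ false
      i⋠j = ≼-strict {i} {j} (∧-conicalˡ (j ≼ i) _ Ky) (outside-block-≢ {i} {j} {b} out)
      kb : clique j b ≡ true
      kb = ∧-conicalʳ (j ≼ i) _ Ky

    h≡E-outside : ∀ i a y → inBlock i y ≡ false → h (inj₁ (i , a)) y ≡ E (inj₁ (i , a)) y
    h≡E-outside i a y out = trans (h-outside i a y out) (sym (E-outside i a y out))

    unit-degree : ∀ {m} (e : Fin m → Vtx ts c) → (∀ {a b} → e a ≡ e b → a ≡ b) →
      (U : Vtx ts c → Bool) → (∀ b → U (e b) ≡ true) → (∀ y → U y ≡ true → ∃ λ b → e b ≡ y) →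
      ∀ x → (∀ y → U y ≡ false → h x y ≡ E x y) →
      sum (λ b → 𝟙 (h x (e b))) ≡ sum (λ b → 𝟙 (E x (e b)))
    unit-degree e e-injective U U-e U-onto x agree = begin
      sum (λ b → 𝟙 (adj H u (e′ b)))      ≡⟨ restrict H ⟨
      sum (λ v → 𝟙 (R v ∧ adj H u v))     ≡⟨ restricted-degree G H u R (same-degree u) agree′ ⟩
      sum (λ v → 𝟙 (R v ∧ adj G u v))     ≡⟨ restrict G ⟩
      sum (λ b → 𝟙 (adj G u (e′ b)))      ≡⟨ sum-cong-≗ (λ b → cong 𝟙 (G-via-φ x (e b))) ⟩
      sum (λ b → 𝟙 (E x (e b)))           ∎
      where
      open ≡-Reasoning
      u : Fin n
      u = from φ x
      R : Fin n → Bool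
      R = U ∘ to φ
      e′ : Fin _ → Fin n
      e′ = from φ ∘ e
      restrict : ∀ X → sum (λ v → 𝟙 (R v ∧ adj X u v)) ≡ sum (λ b → 𝟙 (adj X u (e′ b)))
      restrict X = trans (∑-reindex e′ (e-injective ∘ to-injective (↔-sym φ)) _ support)
        (sum-cong-≗ λ b → cong (λ r → 𝟙 (r ∧ adj X u (e′ b))) (trans (cong U (strictlyInverseˡ φ (e b))) (U-e b)))
        where
        support : ∀ v → 𝟙 (R v ∧ adj X u v) ≡ 0 ⊎ ∃ λ b → e′ b ≡ v
        support v with U (to φ v) in Uv
        ... | false = inj₁ refl
        ... | true  = let (b , eb) = U-onto (to φ v) Uv in
                      inj₂ (b , trans (cong (from φ) eb) (strictlyInverseʳ φ v))
      agree′ : ∀ v → R v ≡ false → adj H u v ≡ adj G u v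
      agree′ v Rv = begin
        adj H u v                  ≡⟨ cong (adj H u) (strictlyInverseʳ φ v) ⟨
        h x (to φ v)               ≡⟨ agree (to φ v) Rv ⟩
        E x (to φ v)               ≡⟨ G-via-φ x (to φ v) ⟨
        adj G u (from φ (to φ v))  ≡⟨ cong (adj G u) (strictlyInverseʳ φ v) ⟩
        adj G u v                  ∎

    block-degree : ∀ i a → sum (λ b → 𝟙 (h (inj₁ (i , a)) (inj₁ (i , b)))) ≡ sum (λ b → 𝟙 (localAdj (lookup ts i) a b))
    block-degree i a =
      trans (unit-degree (λ b → inj₁ (i , b)) (λ { refl → refl }) (inBlock i) (λ _ → ==-refl i) onto
                         (inj₁ (i , a)) (h≡E-outside i a))
            (sum-cong-≗ λ b → cong 𝟙 (blockAdj-same ts i a b))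
      where
      onto : ∀ y → inBlock i y ≡ true → ∃ λ b → inj₁ (i , b) ≡ y
      onto (inj₁ (j , b)) e with ==-sound {a = i} {b = j} e
      ... | refl = b , refl

    isCycle : Vtx ts c → Bool
    isCycle (inj₁ _) = false
    isCycle (inj₂ _) = true

    cycle-degree : ∀ x → sum (λ y → 𝟙 (h (inj₂ x) (inj₂ y))) ≡ sum (λ y → 𝟙 (cAdj c x y))
    cycle-degree x = unit-degree inj₂ (λ { refl → refl }) isCycle (λ _ → refl) onto (inj₂ x) agree
      where
      onto : ∀ y → isCycle y ≡ true → ∃ λ z → inj₂ z ≡ y
      onto (inj₂ z) _ = z , refl
      agree : ∀ y → isCycle y ≡ false → h (inj₂ x) y ≡ E (inj₂ x) y
      agree (inj₁ (j , b)) _ =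
        trans (h-sym _ _) (trans (h-outside j b (inj₂ x) refl) (outsideAdj-none (clique j b)))

    blockLocal : ∀ i → BlockAntimorphism (lookup ts i) (λ a b → h (inj₁ (i , a)) (inj₁ (i , b)))
    blockLocal i = block-antimorphism (lookup ts i) _ (λ _ _ → h-sym _ _) (λ _ → irrefl H _)
      (λ ka kb a≢b → h-complete i _ _ (K≤-self ka) (I≤-self-false kb) (a≢b ∘ λ { refl → refl }))
      (λ ka kb → h-anticomplete i _ _ (I≤-self ka) (K≤-self-false kb))
      (block-degree i)
      where
      I≤-self-false : ∀ {b} → clique i b ≡ true → I≤ i (inj₁ (i , b)) ≡ false
      I≤-self-false kb = cong₂ (λ p k → p ∧ not k) (≼-refl i) kb
      K≤-self-false : ∀ {b} → clique i b ≡ false → K≤ i (inj₁ (i , b)) ≡ false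
      K≤-self-false kb = cong₂ _∧_ (≼-refl i) kb

    cycleLocal : Σ (Fin (csize c) ↔ Fin (csize c)) λ σ → Antimorphism (λ x y → h (inj₂ x) (inj₂ y)) (to σ)
    cycleLocal = cycle-antimorphism c _ (λ _ _ → h-sym _ _) (λ _ → irrefl H _) cycle-degree

    σ : ∀ i → Fin (size (lookup ts i)) ↔ Fin (size (lookup ts i))
    σ i = proj₁ (blockLocal i)

    σ-flips : ∀ i a → clique i (to (σ i) a) ≡ not (clique i a)
    σ-flips i = proj₁ (proj₂ (blockLocal i))

    T : Vtx ts c → Vtx ts c
    T (inj₁ (i , a)) = inj₁ (i , to (σ i) a)
    T (inj₂ x)       = inj₂ (to (proj₁ cycleLocal) x)

    T⁻¹ : Vtx ts c → Vtx ts c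
    T⁻¹ (inj₁ (i , a)) = inj₁ (i , from (σ i) a)
    T⁻¹ (inj₂ x)       = inj₂ (from (proj₁ cycleLocal) x)

    T↔ : Vtx ts c ↔ Vtx ts c
    T↔ = mk↔ₛ′ T T⁻¹ T∘T⁻¹ T⁻¹∘T
      where
      T∘T⁻¹ : ∀ x → T (T⁻¹ x) ≡ x
      T∘T⁻¹ (inj₁ (i , a)) = cong (λ b → inj₁ (i , b)) (strictlyInverseˡ (σ i) a)
      T∘T⁻¹ (inj₂ x)       = cong inj₂ (strictlyInverseˡ (proj₁ cycleLocal) x)
      T⁻¹∘T : ∀ x → T⁻¹ (T x) ≡ x
      T⁻¹∘T (inj₁ (i , a)) = cong (λ b → inj₁ (i , b)) (strictlyInverseʳ (σ i) a)
      T⁻¹∘T (inj₂ x)       = cong inj₂ (strictlyInverseʳ (proj₁ cycleLocal) x)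

    K≤-T : ∀ i y → K≤ i (T y) ≡ I≤ i y
    K≤-T i (inj₁ (j , b)) = cong ((j ≼ i) ∧_) (σ-flips j b)
    K≤-T i (inj₂ _)       = refl

    I≤-T : ∀ i y → I≤ i (T y) ≡ K≤ i y
    I≤-T i (inj₁ (j , b)) = cong ((j ≼ i) ∧_) (trans (cong not (σ-flips j b)) (not-involutive _))
    I≤-T i (inj₂ _)       = refl

    inBlock-T : ∀ i y → inBlock i (T y) ≡ inBlock i y
    inBlock-T i (inj₁ _) = refl
    inBlock-T i (inj₂ _) = refl

    T-antimorphism-outside : ∀ i a y → inBlock i y ≡ false →
      h (inj₁ (i , a)) y ≡ not (h (T (inj₁ (i , a))) (T y))
    T-antimorphism-outside i a y out = begin
      h x y                ≡⟨ not-involutive (h x y) ⟨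
      not (not (h x y))    ≡⟨ cong not flipped ⟨
      not (h (T x) (T y))  ∎
      where
      open ≡-Reasoning
      x : Vtx ts c
      x = inj₁ (i , a)
      a′ : Fin (size (lookup ts i))
      a′ = to (σ i) a
      flipped : h (T x) (T y) ≡ not (h x y)
      flipped = begin
        h (T x) (T y)                                        ≡⟨ h-outside i a′ (T y) (trans (inBlock-T i y) out) ⟩
        outsideAdj (clique i a′) (K≤ i (T y)) (I≤ i (T y))   ≡⟨ cong (λ ka → outsideAdj ka _ _) (σ-flips i a) ⟩
        outsideAdj (not (clique i a)) (K≤ i (T y)) (I≤ i (T y)) ≡⟨ cong₂ (outsideAdj (not (clique i a))) (K≤-T i y) (I≤-T i y) ⟩
        outsideAdj (not (clique i a)) (I≤ i y) (K≤ i y)      ≡⟨ outsideAdj-flip (clique i a) (K≤ i y) (I≤ i y) ⟩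
        not (outsideAdj (clique i a) (K≤ i y) (I≤ i y))      ≡⟨ cong not (h-outside i a y out) ⟨
        not (h x y)                                          ∎

    T-antimorphism : Antimorphism h T
    T-antimorphism (inj₁ (i , a)) (inj₂ y) _ = T-antimorphism-outside i a (inj₂ y) refl
    T-antimorphism (inj₂ x) (inj₁ (j , b)) _ =
      trans (h-sym _ _) (trans (T-antimorphism-outside j b (inj₂ x) refl) (cong not (h-sym _ _)))
    T-antimorphism (inj₂ x) (inj₂ y) x≢y = proj₂ cycleLocal x y (x≢y ∘ cong inj₂)
    T-antimorphism (inj₁ (i , a)) (inj₁ (j , b)) x≢y with ≡-or-≢ i j
    ... | inj₂ i≢j = T-antimorphism-outside i a (inj₁ (j , b)) (==-≢ i≢j)
    ... | inj₁ refl = proj₂ (proj₂ (blockLocal i)) a b (x≢y ∘ cong (λ b → inj₁ (i , b)))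

    antimorphism : Antimorphism (adj H) (to (conjugate φ T↔))
    antimorphism = antimorphism-conjugate (adj H) φ T↔ T-antimorphism

elementary⇒forcibly : ∀ {n} (G : Graph n) ts c (φ : Fin n ↔ Vtx ts c) →
  (∀ u v → adj G u v ≡ elemAdj ts c (to φ u) (to φ v)) →
  ForciblySelfComplementary (degreeSequence G)
elementary⇒forcibly G ts c φ G≅ m H same-sequence =
  antimorphism⇒selfComplementary H (conjugate π (conjugate φ T↔))
    (antimorphism-conjugate (adj H) π (conjugate φ T↔) antimorphism)
  where
  π : Fin m ↔ Fin _
  π = proj₁ (degreeSequence-≡⇒↔ H G same-sequence)

  same-degree : ∀ u → degree (relabel H π) u ≡ degree G u
  same-degree u = begin
    degree (relabel H π) u    ≡⟨ degree-relabel H π u ⟩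
    degree H (from π u)       ≡⟨ proj₂ (degreeSequence-≡⇒↔ H G same-sequence) (from π u) ⟩
    degree G (to π (from π u)) ≡⟨ cong (degree G) (strictlyInverseˡ π u) ⟩
    degree G u                ∎
    where open ≡-Reasoning

  open Elementary ts c φ G G≅
  open Realization (relabel H π) same-degree

lemma12 : ∀ {n : ℕ} (G : Graph n) → ElementarySCPseudoSplit G →
    (SelfComplementary G × PseudoSplit G) × ForciblySelfComplementary (degreeSequence G)
lemma12 G (ts , c , φ , G≅) =
  (forcibly _ G refl , Elementary.pseudoSplit ts c φ G G≅) , forcibly
  where
  forcibly : ForciblySelfComplementary (degreeSequence G)
  forcibly = elementary⇒forcibly G ts c φ G≅
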